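{- Let $a\in\mathbb N$. In the infinite Jaco graph $J_\infty(a)$ we have, for every $n\in\mathbb N$, $d^-(v_{n+1})=(n+1)-c_{a,n+1}\in\{n-c_{a,n},\,n-c_{a,n}+1\}$. Moreover the sequence $(c_{a,n})_{n\in\mathbb N_0}$ is well defined and non-decreasing; more specifically $c_{a,n+1}\in\{c_{a,n},\,c_{a,n}+1\}$ for all $n\in\mathbb N_0$.
   Context: $\mathbb N=\{1,2,3,\dots\}$, $\mathbb N_0=\mathbb N\cup\{0\}$. For $a\in\mathbb N$, the infinite Jaco graph $J_\infty(a)$ is the directed graph with vertex set $\{v_i: i\in\mathbb N\}$ in which every arc has the form $(v_i,v_j)$ with $i<j$, and for $i<j$, $(v_i,v_j)$ is an arc if and only if $(a+1)i-d^-(v_i)\ge j$, where $d^-(v_i)$ is the in-degree of $v_i$ (determined recursively, since arcs into $v_i$ come only from lower-indexed vertices). The sequence $(c_{a,n})_{n\in\mathbb N_0}$ is defined by $c_{a,0}=0$, $c_{a,1}=1$, and $c_{a,n}=\min\{k<n : ak+c_{a,k}\ge n\}$ for $n\ge 2$. -}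

module Defs where

open import Data.Nat using (ℕ; zero; suc; _+_; _*_; _≤_; _<_; _≤?_)
open import Data.List using (List; []; length; filter; map; upTo)
open import Data.Product using (_×_)
open import Relation.Nullary using (yes; no)
open import Relation.Binary.PropositionalEquality using (_≡_)

-- Vertices of J∞(a) are v_i, i ≥ 1 (index 0 is unused).
-- Predecessor indices of v_j : 1, 2, …, j-1.
preds : ℕ → List ℕ
preds zero    = []
preds (suc n) = map suc (upTo n)

-- degTable a n i = d⁻(v_i) in J∞(a), valid for 1 ≤ i ≤ n.
-- The arc condition (a+1)i - d⁻(v_i) ≥ j is written without truncated
-- subtraction as  j + d⁻(v_i) ≤ (a+1) i.
degTable : ℕ → ℕ → ℕ → ℕ
degTable a zero    i = 0
degTable a (suc n) i with i ≤? n
... | yes _ = degTable a n i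
... | no  _ = length (filter (λ k → suc n + degTable a n k ≤? suc a * k) (preds (suc n)))

inDeg : ℕ → ℕ → ℕ
inDeg a j = degTable a j j

Arc : ℕ → ℕ → ℕ → Set
Arc a i j = 1 ≤ i × i < j × j + inDeg a i ≤ suc a * i

-- c is the sequence (c_{a,n}) : c 0 = 0, c 1 = 1, and for n ≥ 2,
-- c n = min { k < n : a k + c k ≥ n }  (the minimum exists and equals c n).
record IsCSeq (a : ℕ) (c : ℕ → ℕ) : Set where
  field
    c0   : c 0 ≡ 0
    c1   : c 1 ≡ 1
    lt   : ∀ n → 2 ≤ n → c n < n
    attn : ∀ n → 2 ≤ n → n ≤ a * c n + c (c n)
    minm : ∀ n → 2 ≤ n → ∀ k → k < c n → a * k + c k < n

-- By induction on n: if d⁻(v_k) = k − c k for all k ≤ n, then (v_k, v_{n+1}) is an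
-- arc iff n + 1 ≤ a k + c k. This bound is non-decreasing in k, and the least k
-- attaining it is c (n + 1); hence v_{n+1} has exactly (n + 1) − c (n + 1)
-- in-neighbours. The sequence c exists because c (n + 1) is either c n or c n + 1,
-- according to whether a (c n) + c (c n) already reaches n + 1, and it is unique
-- because the defining minimum is.
module Submission where

open import Defs
open import Data.Nat using (ℕ; zero; suc; _+_; _*_; _∸_; _≤_; _<_; _≤?_; _≰_; _≮_; z≤n; s≤s)
open import Data.Nat.Properties
open import Data.Nat.Induction using (<-rec)
open import Data.List using (List; []; _∷_; _++_; length; filter; map; upTo)
open import Data.List.Properties using (upTo-∷ʳ; map-++; length-++; filter-++; filter-accept; filter-reject)
open import Data.Product using (Σ; _×_; _,_)
open import Data.Sum using (_⊎_; inj₁; inj₂)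
open import Function.Base using (_∘_)
open import Function.Bundles using (_⇔_; mk⇔; module Equivalence)
open import Function.Construct.Composition using (_⇔-∘_)
open import Relation.Nullary using (yes; no; contradiction)
open import Relation.Unary using (Pred; Decidable)
open import Relation.Binary.PropositionalEquality

preds-suc : ∀ n → preds (suc (suc n)) ≡ preds (suc n) ++ suc n ∷ []
preds-suc n = trans (cong (map suc) (sym (upTo-∷ʳ n))) (map-++ suc (upTo n) (n ∷ []))

module _ {p} {P : Pred ℕ p} (P? : Decidable P) where

  length-filter-preds-suc : ∀ n → length (filter P? (preds (suc (suc n))))
                                ≡ length (filter P? (preds (suc n))) + length (filter P? (suc n ∷ []))
  length-filter-preds-suc n = begin
    length (filter P? (preds (suc (suc n))))
      ≡⟨ cong (λ xs → length (filter P? xs)) (preds-suc n) ⟩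
    length (filter P? (preds (suc n) ++ suc n ∷ []))
      ≡⟨ cong length (filter-++ P? (preds (suc n)) (suc n ∷ [])) ⟩
    length (filter P? (preds (suc n)) ++ filter P? (suc n ∷ []))
      ≡⟨ length-++ (filter P? (preds (suc n))) ⟩
    length (filter P? (preds (suc n))) + length (filter P? (suc n ∷ [])) ∎
    where open ≡-Reasoning

  length-filter-upperSet : ∀ {m} n → 1 ≤ m → (∀ k → 1 ≤ k → k ≤ n → P k ⇔ m ≤ k) →
                           length (filter P? (preds (suc n))) ≡ suc n ∸ m
  length-filter-upperSet zero (s≤s {n = m} z≤n) _ = sym (0∸n≡0 m)
  length-filter-upperSet {m} (suc n) 1≤m P⇔ = begin
    length (filter P? (preds (suc (suc n))))
      ≡⟨ length-filter-preds-suc n ⟩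
    length (filter P? (preds (suc n))) + length (filter P? [1+n])
      ≡⟨ cong (_+ length (filter P? [1+n])) (length-filter-upperSet n 1≤m P⇔-below) ⟩
    suc n ∸ m + length (filter P? [1+n])
      ≡⟨ ∸+length-filter-last ⟩
    suc (suc n) ∸ m ∎
    where
      open ≡-Reasoning
      open Equivalence (P⇔ (suc n) (s≤s z≤n) ≤-refl)
      [1+n] : List ℕ
      [1+n] = suc n ∷ []
      P⇔-below : ∀ k → 1 ≤ k → k ≤ n → P k ⇔ m ≤ k
      P⇔-below k 1≤k k≤n = P⇔ k 1≤k (m≤n⇒m≤1+n k≤n)
      ∸+length-filter-last : suc n ∸ m + length (filter P? [1+n]) ≡ suc (suc n) ∸ m
      ∸+length-filter-last with m ≤? suc n
      ... | yes m≤1+n = begin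
        suc n ∸ m + length (filter P? [1+n])
          ≡⟨ cong (λ xs → suc n ∸ m + length xs) (filter-accept P? (from m≤1+n)) ⟩
        suc n ∸ m + 1       ≡⟨ +-∸-comm 1 m≤1+n ⟨
        suc n + 1 ∸ m       ≡⟨ cong (_∸ m) (+-comm (suc n) 1) ⟩
        suc (suc n) ∸ m     ∎
      ... | no m≰1+n = begin
        suc n ∸ m + length (filter P? [1+n])
          ≡⟨ cong (λ xs → suc n ∸ m + length xs) (filter-reject P? (m≰1+n ∘ to)) ⟩
        suc n ∸ m + 0       ≡⟨ +-identityʳ (suc n ∸ m) ⟩
        suc n ∸ m           ≡⟨ m≤n⇒m∸n≡0 (<⇒≤ (≰⇒> m≰1+n)) ⟩
        0                   ≡⟨ m≤n⇒m∸n≡0 (≰⇒> m≰1+n) ⟨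
        suc (suc n) ∸ m     ∎

table-stable : (T : ℕ → ℕ → ℕ) → (∀ n i → i ≤ n → T (suc n) i ≡ T n i) →
               ∀ n i → i ≤ n → T n i ≡ T i i
table-stable T below zero .zero z≤n = refl
table-stable T below (suc n) i i≤1+n with m≤n⇒m<n∨m≡n i≤1+n
... | inj₁ (s≤s i≤n) = trans (below n i i≤n) (table-stable T below n i i≤n)
... | inj₂ refl      = refl

degTable-stable : ∀ a n i → i ≤ n → degTable a n i ≡ inDeg a i
degTable-stable a = table-stable (degTable a) below
  where
    below : ∀ n i → i ≤ n → degTable a (suc n) i ≡ degTable a n i
    below n i i≤n with i ≤? n
    ... | yes _   = refl
    ... | no i≰n = contradiction i≤n i≰n

inDeg-suc : ∀ a n → inDeg a (suc n)
            ≡ length (filter (λ k → suc n + degTable a n k ≤? suc a * k) (preds (suc n)))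
inDeg-suc a n with suc n ≤? n
... | yes 1+n≤n = contradiction 1+n≤n (n≮n n)
... | no _       = refl

module CSequence (a : ℕ) where

  next : ℕ → ℕ → ℕ → ℕ
  next n x y with suc n ≤? a * x + y
  ... | yes _ = x
  ... | no _  = suc x

  next-accept : ∀ {n x y} → suc n ≤ a * x + y → next n x y ≡ x
  next-accept {n} {x} {y} 1+n≤ with suc n ≤? a * x + y
  ... | yes _   = refl
  ... | no 1+n≰ = contradiction 1+n≤ 1+n≰

  next-reject : ∀ {n x y} → suc n ≰ a * x + y → next n x y ≡ suc x
  next-reject {n} {x} {y} 1+n≰ with suc n ≤? a * x + y
  ... | yes 1+n≤ = contradiction 1+n≤ 1+n≰
  ... | no _     = refl

  next-≤ : ∀ n x y → next n x y ≤ suc x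
  next-≤ n x y with suc n ≤? a * x + y
  ... | yes _ = n≤1+n x
  ... | no _  = ≤-refl

  -- cTable n i = c i for i ≤ n; the table turns the course-of-values recursion
  -- c (n + 1) = next n (c n) (c (c n)) into a structural one, as degTable does for d⁻.
  cTable : ℕ → ℕ → ℕ
  cTable zero    i = 0
  cTable (suc n) i with i ≤? n
  ... | yes _ = cTable n i
  ... | no _  = next n (cTable n n) (cTable n (cTable n n))

  c : ℕ → ℕ
  c n = cTable n n

  -- Once d⁻(v_k) = k − c k is known, reach k is the largest j with an arc (v_k, v_j).
  reach : ℕ → ℕ
  reach k = a * k + c k

  cTable-stable : ∀ n i → i ≤ n → cTable n i ≡ c i
  cTable-stable = table-stable cTable below
    where
      below : ∀ n i → i ≤ n → cTable (suc n) i ≡ cTable n i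
      below n i i≤n with i ≤? n
      ... | yes _   = refl
      ... | no i≰n = contradiction i≤n i≰n

  c-suc-cTable : ∀ n → c (suc n) ≡ next n (c n) (cTable n (c n))
  c-suc-cTable n with suc n ≤? n
  ... | yes 1+n≤n = contradiction 1+n≤n (n≮n n)
  ... | no _       = refl

  c-≤ : ∀ n → c n ≤ n
  c-≤ zero    = z≤n
  c-≤ (suc n) = begin
    c (suc n)                        ≡⟨ c-suc-cTable n ⟩
    next n (c n) (cTable n (c n))    ≤⟨ next-≤ n (c n) _ ⟩
    suc (c n)                        ≤⟨ s≤s (c-≤ n) ⟩
    suc n                            ∎
    where open ≤-Reasoning

  c-suc-next : ∀ n → c (suc n) ≡ next n (c n) (c (c n))
  c-suc-next n = trans (c-suc-cTable n) (cong (next n (c n)) (cTable-stable n (c n) (c-≤ n)))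

  c-suc-stay : ∀ n → suc n ≤ reach (c n) → c (suc n) ≡ c n
  c-suc-stay n 1+n≤ = trans (c-suc-next n) (next-accept 1+n≤)

  c-suc-bump : ∀ n → suc n ≰ reach (c n) → c (suc n) ≡ suc (c n)
  c-suc-bump n 1+n≰ = trans (c-suc-next n) (next-reject 1+n≰)

  c-suc : ∀ n → c (suc n) ≡ c n ⊎ c (suc n) ≡ suc (c n)
  c-suc n with suc n ≤? reach (c n)
  ... | yes 1+n≤ = inj₁ (c-suc-stay n 1+n≤)
  ... | no 1+n≰  = inj₂ (c-suc-bump n 1+n≰)

  c-≤-c-suc : ∀ n → c n ≤ c (suc n)
  c-≤-c-suc n with c-suc n
  ... | inj₁ eq = ≤-reflexive (sym eq)
  ... | inj₂ eq = ≤-trans (n≤1+n (c n)) (≤-reflexive (sym eq))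

  c-mono : ∀ {m n} → m ≤ n → c m ≤ c n
  c-mono {n = zero}  z≤n = ≤-refl
  c-mono {n = suc n} m≤1+n with m≤n⇒m<n∨m≡n m≤1+n
  ... | inj₁ (s≤s m≤n) = ≤-trans (c-mono m≤n) (c-≤-c-suc n)
  ... | inj₂ refl      = ≤-refl

  c-1 : c 1 ≡ 1
  c-1 = c-suc-bump 0 λ 1≤reach0 → contradiction (subst (1 ≤_) reach-0 1≤reach0) λ ()
    where
      reach-0 : reach 0 ≡ 0
      reach-0 = trans (+-identityʳ (a * 0)) (*-zeroʳ a)

  c-pos : ∀ {n} → 1 ≤ n → 1 ≤ c n
  c-pos {n} 1≤n = subst (_≤ c n) c-1 (c-mono 1≤n)

  reach-mono : ∀ {k l} → k ≤ l → reach k ≤ reach l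
  reach-mono k≤l = +-mono-≤ (*-monoʳ-≤ a k≤l) (c-mono k≤l)

  reach-below-c : ∀ n k → k < c n → reach k < n
  reach-below-c (suc n) k k<c[1+n] with suc n ≤? reach (c n)
  ... | yes 1+n≤ = m<n⇒m<1+n (reach-below-c n k (subst (k <_) (c-suc-stay n 1+n≤) k<c[1+n]))
  ... | no 1+n≰  = ≤-<-trans (reach-mono (≤-pred (subst (k <_) (c-suc-bump n 1+n≰) k<c[1+n])))
                             (≰⇒> 1+n≰)

  module _ (1≤a : 1 ≤ a) where

    reach-suc : ∀ k → reach k < reach (suc k)
    reach-suc k = +-mono-<-≤ a*k<a*[1+k] (c-≤-c-suc k)
      where
        a*k<a*[1+k] : a * k < a * suc k
        a*k<a*[1+k] = ≤-trans (+-monoˡ-≤ (a * k) 1≤a) (≤-reflexive (sym (*-suc a k)))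

    reach-c : ∀ n → n ≤ reach (c n)
    reach-c zero = z≤n
    reach-c (suc n) with suc n ≤? reach (c n)
    ... | yes 1+n≤ = subst (λ x → suc n ≤ reach x) (sym (c-suc-stay n 1+n≤)) 1+n≤
    ... | no 1+n≰  = subst (λ x → suc n ≤ reach x) (sym (c-suc-bump n 1+n≰))
                          (≤-trans (s≤s (reach-c n)) (reach-suc (c n)))

    ≤-reach⇔c-≤ : ∀ n k → n ≤ reach k ⇔ c n ≤ k
    ≤-reach⇔c-≤ n k = mk⇔
      (λ n≤reach-k → ≮⇒≥ λ k<cn → <⇒≱ (reach-below-c n k k<cn) n≤reach-k)
      (λ cn≤k → ≤-trans (reach-c n) (reach-mono cn≤k))

    suc-≤-reach : ∀ {n} → 1 ≤ n → suc n ≤ reach n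
    suc-≤-reach {n} 1≤n = begin
      suc n       ≡⟨ +-comm 1 n ⟩
      n + 1       ≤⟨ +-mono-≤ n≤a*n (c-pos 1≤n) ⟩
      a * n + c n ∎
      where
        open ≤-Reasoning
        n≤a*n : n ≤ a * n
        n≤a*n = ≤-trans (≤-reflexive (sym (*-identityˡ n))) (*-monoˡ-≤ n 1≤a)

    c-< : ∀ n → 2 ≤ n → c n < n
    c-< (suc n) (s≤s 1≤n) = s≤s (Equivalence.to (≤-reach⇔c-≤ (suc n) n) (suc-≤-reach 1≤n))

    c-isCSeq : IsCSeq a c
    c-isCSeq = record
      { c0   = refl
      ; c1   = c-1
      ; lt   = c-<
      ; attn = λ n _ → reach-c n
      ; minm = λ n _ → reach-below-c n
      }

    arc⇔≤-reach : ∀ {j k} d → d + c k ≡ k → j + d ≤ suc a * k ⇔ j ≤ reach k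
    arc⇔≤-reach {j} {k} d d+ck≡k = mk⇔
      (λ j+d≤ → +-cancelˡ-≤ d j (reach k) (subst₂ _≤_ (+-comm j d) [1+a]*k≡d+reach j+d≤))
      (λ j≤ → subst₂ _≤_ (+-comm d j) (sym [1+a]*k≡d+reach) (+-monoʳ-≤ d j≤))
      where
        open ≡-Reasoning
        [1+a]*k≡d+reach : suc a * k ≡ d + reach k
        [1+a]*k≡d+reach = begin
          k + a * k         ≡⟨ cong (_+ a * k) d+ck≡k ⟨
          d + c k + a * k   ≡⟨ +-assoc d (c k) (a * k) ⟩
          d + (c k + a * k) ≡⟨ cong (d +_) (+-comm (c k) (a * k)) ⟩
          d + reach k       ∎

    inDeg+c-suc : ∀ n → (∀ k → k ≤ n → inDeg a k + c k ≡ k) → inDeg a (suc n) + c (suc n) ≡ suc n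
    inDeg+c-suc n ih = begin
      inDeg a (suc n) + c (suc n)        ≡⟨ cong (_+ c (suc n)) (trans (inDeg-suc a n) count) ⟩
      suc n ∸ c (suc n) + c (suc n)      ≡⟨ m∸n+n≡m (c-≤ (suc n)) ⟩
      suc n                              ∎
      where
        open ≡-Reasoning
        arc⇔ : ∀ k → 1 ≤ k → k ≤ n → suc n + degTable a n k ≤ suc a * k ⇔ c (suc n) ≤ k
        arc⇔ k _ k≤n rewrite degTable-stable a n k k≤n =
          ≤-reach⇔c-≤ (suc n) k ⇔-∘ arc⇔≤-reach (inDeg a k) (ih k k≤n)
        count : length (filter (λ k → suc n + degTable a n k ≤? suc a * k) (preds (suc n)))
                ≡ suc n ∸ c (suc n)
        count = length-filter-upperSet (λ k → suc n + degTable a n k ≤? suc a * k) n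
                                       (c-pos {suc n} (s≤s z≤n)) arc⇔

    inDeg+c : ∀ n → inDeg a n + c n ≡ n
    inDeg+c = <-rec _ λ
      { zero    _  → refl
      ; (suc n) ih → inDeg+c-suc n λ k k≤n → ih (s≤s k≤n)
      }

    inDeg-suc+c : ∀ n → inDeg a (suc n) + c n ≡ n ⊎ inDeg a (suc n) + c n ≡ n + 1
    inDeg-suc+c n with c-suc n
    ... | inj₁ c[1+n]≡cn = inj₂ (begin
      inDeg a (suc n) + c n       ≡⟨ cong (inDeg a (suc n) +_) c[1+n]≡cn ⟨
      inDeg a (suc n) + c (suc n) ≡⟨ inDeg+c (suc n) ⟩
      suc n                       ≡⟨ +-comm 1 n ⟩
      n + 1                       ∎)
      where open ≡-Reasoning
    ... | inj₂ c[1+n]≡1+cn = inj₁ (suc-injective (begin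
      suc (inDeg a (suc n) + c n) ≡⟨ +-suc (inDeg a (suc n)) (c n) ⟨
      inDeg a (suc n) + suc (c n) ≡⟨ cong (inDeg a (suc n) +_) c[1+n]≡1+cn ⟨
      inDeg a (suc n) + c (suc n) ≡⟨ inDeg+c (suc n) ⟩
      suc n                       ∎))
      where open ≡-Reasoning

-- If c n < c′ n, then k = c n is below the minimum defining c′ n although it reaches n.
IsCSeq-≮ : ∀ {a c c′} → IsCSeq a c → IsCSeq a c′ → ∀ n → 2 ≤ n →
           (∀ k → k < n → c k ≡ c′ k) → c n ≮ c′ n
IsCSeq-≮ {a} {c} isC isC′ n 2≤n c≡c′ cn<c′n =
  <⇒≱ (IsCSeq.minm isC′ n 2≤n (c n) cn<c′n)
      (subst (λ x → n ≤ a * c n + x) (c≡c′ (c n) (IsCSeq.lt isC n 2≤n)) (IsCSeq.attn isC n 2≤n))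

IsCSeq-unique : ∀ {a c c′} → IsCSeq a c → IsCSeq a c′ → ∀ n → c n ≡ c′ n
IsCSeq-unique {c = c} {c′} isC isC′ = <-rec _ go
  where
    go : ∀ n → (∀ {k} → k < n → c k ≡ c′ k) → c n ≡ c′ n
    go zero                _  = trans (IsCSeq.c0 isC) (sym (IsCSeq.c0 isC′))
    go (suc zero)          _  = trans (IsCSeq.c1 isC) (sym (IsCSeq.c1 isC′))
    go n@(suc (suc _))     ih = ≤-antisym
      (≮⇒≥ (IsCSeq-≮ isC′ isC n (s≤s (s≤s z≤n)) λ k k<n → sym (ih k<n)))
      (≮⇒≥ (IsCSeq-≮ isC isC′ n (s≤s (s≤s z≤n)) λ k → ih))

corollary1p2 : (a : ℕ) → 1 ≤ a →
    (Σ (ℕ → ℕ) (λ c → IsCSeq a c)) ×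
    (∀ (c : ℕ → ℕ) → IsCSeq a c →
      (∀ n → 1 ≤ n →
        (inDeg a (suc n) + c (suc n) ≡ suc n) ×
        ((inDeg a (suc n) + c n ≡ n) ⊎ (inDeg a (suc n) + c n ≡ n + 1))) ×
      (∀ m n → m ≤ n → c m ≤ c n) ×
      (∀ n → (c (suc n) ≡ c n) ⊎ (c (suc n) ≡ suc (c n))))
corollary1p2 a 1≤a = (c , c-isCSeq 1≤a) , λ c′ c′-isCSeq →
  let c≡c′ = IsCSeq-unique (c-isCSeq 1≤a) c′-isCSeq in
    (λ n _ →
        subst (λ x → inDeg a (suc n) + x ≡ suc n) (c≡c′ (suc n)) (inDeg+c 1≤a (suc n))
      , subst (λ x → inDeg a (suc n) + x ≡ n ⊎ inDeg a (suc n) + x ≡ n + 1) (c≡c′ n) (inDeg-suc+c 1≤a n))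
  , (λ m n m≤n → subst₂ _≤_ (c≡c′ m) (c≡c′ n) (c-mono m≤n))
  , (λ n → subst₂ (λ x y → y ≡ x ⊎ y ≡ suc x) (c≡c′ n) (c≡c′ (suc n)) (c-suc n))
  where open CSequence a
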